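{- Let $a,b,c$ be positive integers with $a\leqslant b\leqslant c$. Suppose that every nonnegative integer $n$ can be written as $n=x(ax+1)+y(by+1)+z(cz+1)$ with $x,y,z\in\mathbb{Z}$. Then $(a,b,c)$ is one of the following $17$ triples: $$(1,1,2),(1,2,2),(1,2,3),(1,2,4),(1,2,5),(2,2,2),(2,2,3),(2,2,4),(2,2,5),(2,2,6),$$ $$(2,3,3),(2,3,4),(2,3,5),(2,3,7),(2,3,8),(2,3,9),(2,3,10).$$ -}

module Defs where

open import Data.Nat using (ℕ)
open import Data.Integer using (ℤ; +_; _+_; _*_)
open import Data.Product using (_×_; _,_; ∃-syntax)
open import Data.List using (List; _∷_; [])
open import Relation.Binary.PropositionalEquality using (_≡_)

tri : ℕ → ℤ → ℤ
tri a x = x * ((+ a) * x + + 1)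

Represents : ℕ → ℕ → ℕ → ℕ → Set
Represents a b c n = ∃[ x ] ∃[ y ] ∃[ z ] (tri a x + tri b y + tri c z ≡ + n)

triples : List (ℕ × ℕ × ℕ)
triples =
  (1 , 1 , 2) ∷ (1 , 2 , 2) ∷ (1 , 2 , 3) ∷ (1 , 2 , 4) ∷ (1 , 2 , 5) ∷
  (2 , 2 , 2) ∷ (2 , 2 , 3) ∷ (2 , 2 , 4) ∷ (2 , 2 , 5) ∷ (2 , 2 , 6) ∷
  (2 , 3 , 3) ∷ (2 , 3 , 4) ∷ (2 , 3 , 5) ∷ (2 , 3 , 7) ∷ (2 , 3 , 8) ∷
  (2 , 3 , 9) ∷ (2 , 3 , 10) ∷ []

-- For a coefficient a = 1 + a' the polynomial x(ax+1) takes only natural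
-- values on ℤ; we compute it as a natural number  tri⁺ a' x  and record two
-- facts about it: every nonzero value is at least a - 1 = a' (the value at
-- x = -1), and |x| is bounded by the value.  Consequently the values that can
-- occur in a representation of n lie in an explicit finite list
-- candidates a' n, which is just [0] when n < a'.  A representation of n thus
-- yields a sum p + q + r = n with p, q, r taken from three finite lists, and
-- the absence of such a sum is decidable, so a single number n can be refuted
-- by computation ('refute').
--
-- The theorem is a case analysis on (a, b, c): whenever the triple is not in
-- the list, some small n (1, 2, 4, 5, 9 or 48) is refuted.  Large unknown
-- coefficients are handled because their candidate lists evaluate to [0].
module Submission where

open import Defs
open import Data.Empty using (⊥-elim)
open import Data.Bool using (true; false; if_then_else_; T)
open import Data.Integer as ℤ using (ℤ; +_; -[1+_])
open import Data.Integer.Properties as ℤP using (pos-*)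
open import Data.List using (List; []; _∷_; filter; map; upTo; _++_)
open import Data.List.Membership.Propositional using (_∈_)
open import Data.List.Membership.Propositional.Properties
  using (∈-filter⁺; ∈-++⁺ˡ; ∈-++⁺ʳ; ∈-map⁺; ∈-upTo⁺)
open import Data.List.Relation.Unary.Any as Any using (Any; here; any?)
open import Data.Nat using (ℕ; zero; suc; _+_; _*_; _≤_; _<_; _≤?_; _≟_; _<ᵇ_; s≤s)
open import Data.Nat.Properties
  using (≤-trans; ≤-reflexive; ≤-<-trans; <⇒≱; <ᵇ⇒<; n≤1+n; m≤m+n; m≤n+m; m≤m*n; *-monoʳ-≤; *-identityʳ; *-zeroʳ)
open import Data.Product using (_,_)
open import Data.Product.Properties using (≡-dec)
open import Data.List.Membership.DecPropositional (≡-dec _≟_ (≡-dec _≟_ _≟_)) using (_∈?_)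
open import Data.Unit using (tt)
open import Relation.Nullary using (¬_; Dec; contradiction)
open import Relation.Nullary.Decidable using (True; False; toWitness; toWitnessFalse)
open import Relation.Binary.PropositionalEquality using (_≡_; refl; sym; trans; cong; cong₂; subst)

Universal : ℕ → ℕ → ℕ → Set
Universal a b c = (n : ℕ) → Represents a b c n

tri⁺ : ℕ → ℤ → ℕ
tri⁺ a' (+ k)    = k * (suc a' * k + 1)
tri⁺ a' -[1+ m ] = suc m * (m + a' * suc m)

-- For x = -(m+1):  x(ax+1) = (m+1)(a(m+1) - 1) = (m+1)(m + a'(m+1)).
tri-negative : ∀ a' m → tri (suc a') -[1+ m ] ≡ + tri⁺ a' -[1+ m ]
tri-negative a' m = neg-product m (m + a' * suc m)
  where
  neg-product : ∀ m t → -[1+ m ] ℤ.* (-[1+ t ] ℤ.+ + 1) ≡ + (suc m * t)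
  neg-product m zero    = trans (ℤP.*-zeroʳ -[1+ m ]) (cong +_ (sym (*-zeroʳ (suc m))))
  neg-product m (suc t) = refl

tri-as-ℕ : ∀ a' x → tri (suc a') x ≡ + tri⁺ a' x
tri-as-ℕ a' (+ k)    = trans (cong (λ u → + k ℤ.* (u ℤ.+ + 1)) (sym (pos-* (suc a') k)))
                             (sym (pos-* k (suc a' * k + 1)))
tri-as-ℕ a' -[1+ m ] = tri-negative a' m

tri⁺-gap : ∀ a' x → tri⁺ a' x < a' → tri⁺ a' x ≡ 0
tri⁺-gap a' (+ zero)  _ = refl
tri⁺-gap a' (+ suc k) h = contradiction
  (≤-trans (≤-trans (n≤1+n a') (m≤m*n (suc a') (suc k)))
           (≤-trans (m≤m+n (suc a' * suc k) 1) (m≤m+n _ _)))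
  (<⇒≱ h)
tri⁺-gap a' -[1+ m ]  h = contradiction
  (≤-trans (m≤m*n a' (suc m)) (≤-trans (m≤n+m _ m) (m≤m+n _ _)))
  (<⇒≱ h)

index-bound⁺ : ∀ a' k → k ≤ tri⁺ a' (+ k)
index-bound⁺ a' k = ≤-trans (≤-reflexive (sym (*-identityʳ k))) (*-monoʳ-≤ k (m≤n+m 1 (suc a' * k)))

index-bound⁻ : ∀ a' m → m ≤ tri⁺ a' -[1+ m ]
index-bound⁻ a' m = ≤-trans (m≤m+n m (a' * suc m)) (m≤m+n _ _)

values : ℕ → ℕ → List ℕ
values a' n = filter (_≤? n) (map (λ k → tri⁺ a' (+ k)) (upTo (suc n))
                              ++ map (λ m → tri⁺ a' -[1+ m ]) (upTo (suc n)))

∈-values : ∀ a' n x → tri⁺ a' x ≤ n → tri⁺ a' x ∈ values a' n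
∈-values a' n (+ k) h = ∈-filter⁺ (_≤? n)
  (∈-++⁺ˡ (∈-map⁺ (λ k → tri⁺ a' (+ k)) (∈-upTo⁺ (s≤s (≤-trans (index-bound⁺ a' k) h))))) h
∈-values a' n -[1+ m ] h = ∈-filter⁺ (_≤? n)
  (∈-++⁺ʳ (map (λ k → tri⁺ a' (+ k)) (upTo (suc n)))
          (∈-map⁺ (λ m → tri⁺ a' -[1+ m ]) (∈-upTo⁺ (s≤s (≤-trans (index-bound⁻ a' m) h))))) h

-- The possible values ≤ n; by the gap neg-product only 0 is possible when n < a'.
-- The test n <ᵇ a' evaluates as soon as a' is known to exceed the literal n.
candidates : ℕ → ℕ → List ℕ
candidates a' n = if n <ᵇ a' then 0 ∷ [] else values a' n

∈-candidates : ∀ a' n x → tri⁺ a' x ≤ n → tri⁺ a' x ∈ candidates a' n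
∈-candidates a' n x h with n <ᵇ a' in n<ᵇa'
... | true  = here (tri⁺-gap a' x (≤-<-trans h (<ᵇ⇒< n a' (subst T (sym n<ᵇa') tt))))
... | false = ∈-values a' n x h

SumOf : List ℕ → List ℕ → List ℕ → ℕ → Set
SumOf P Q R n = Any (λ p → Any (λ q → Any (λ r → p + q + r ≡ n) R) Q) P

sumOf? : ∀ P Q R n → Dec (SumOf P Q R n)
sumOf? P Q R n = any? (λ p → any? (λ q → any? (λ r → p + q + r ≟ n) R) Q) P

sumOf-intro : ∀ {P Q R n p q r} → p ∈ P → q ∈ Q → r ∈ R → p + q + r ≡ n → SumOf P Q R n
sumOf-intro p∈ q∈ r∈ e =
  Any.map (λ { refl → Any.map (λ { refl → Any.map (λ { refl → e }) r∈ }) q∈ }) p∈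

represents⇒sumOf : ∀ a' b' c' n → Represents (suc a') (suc b') (suc c') n →
                   SumOf (candidates a' n) (candidates b' n) (candidates c' n) n
represents⇒sumOf a' b' c' n (x , y , z , e) =
  sumOf-intro (∈-candidates a' n x p≤n) (∈-candidates b' n y q≤n) (∈-candidates c' n z r≤n) sum≡n
  where
  p = tri⁺ a' x
  q = tri⁺ b' y
  r = tri⁺ c' z
  sum≡n : p + q + r ≡ n
  sum≡n = ℤP.+-injective (trans (sym (cong₂ ℤ._+_ (cong₂ ℤ._+_ (tri-as-ℕ a' x) (tri-as-ℕ b' y))
                                                  (tri-as-ℕ c' z))) e)
  p≤n : p ≤ n
  p≤n = subst (p ≤_) sum≡n (≤-trans (m≤m+n p q) (m≤m+n (p + q) r))
  q≤n : q ≤ n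
  q≤n = subst (q ≤_) sum≡n (≤-trans (m≤n+m q p) (m≤m+n (p + q) r))
  r≤n : r ≤ n
  r≤n = subst (r ≤_) sum≡n (m≤n+m r (p + q))

refute : ∀ a' b' c' n → {False (sumOf? (candidates a' n) (candidates b' n) (candidates c' n) n)} →
         ¬ Represents (suc a') (suc b') (suc c') n
refute a' b' c' n {none} rep = toWitnessFalse none (represents⇒sumOf a' b' c' n rep)

listed : ∀ {t} → {True (t ∈? triples)} → t ∈ triples
listed {_} {found} = toWitness found

universal-1-1 : ∀ c → 1 ≤ c → Universal 1 1 c → (1 , 1 , c) ∈ triples
universal-1-1 1                   _ R = ⊥-elim (refute 0 0 0 1 (R 1))
universal-1-1 2                   _ R = listed
universal-1-1 (suc (suc (suc c))) _ R = ⊥-elim (refute 0 0 (suc (suc c)) 1 (R 1))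

universal-1-2 : ∀ c → 2 ≤ c → Universal 1 2 c → (1 , 2 , c) ∈ triples
universal-1-2 1 (s≤s ()) _
universal-1-2 2 _ R = listed
universal-1-2 3 _ R = listed
universal-1-2 4 _ R = listed
universal-1-2 5 _ R = listed
universal-1-2 (suc (suc (suc (suc (suc (suc c)))))) _ R =
  ⊥-elim (refute 0 1 (suc (suc (suc (suc (suc c))))) 4 (R 4))

universal-2-2 : ∀ c → 2 ≤ c → Universal 2 2 c → (2 , 2 , c) ∈ triples
universal-2-2 1 (s≤s ()) _
universal-2-2 2 _ R = listed
universal-2-2 3 _ R = listed
universal-2-2 4 _ R = listed
universal-2-2 5 _ R = listed
universal-2-2 6 _ R = listed
universal-2-2 (suc (suc (suc (suc (suc (suc (suc c))))))) _ R =
  ⊥-elim (refute 1 1 (suc (suc (suc (suc (suc (suc c)))))) 5 (R 5))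

universal-2-3 : ∀ c → 3 ≤ c → Universal 2 3 c → (2 , 3 , c) ∈ triples
universal-2-3 1  (s≤s ()) _
universal-2-3 2  (s≤s (s≤s ())) _
universal-2-3 3  _ R = listed
universal-2-3 4  _ R = listed
universal-2-3 5  _ R = listed
universal-2-3 6  _ R = ⊥-elim (refute 1 2 5 48 (R 48))
universal-2-3 7  _ R = listed
universal-2-3 8  _ R = listed
universal-2-3 9  _ R = listed
universal-2-3 10 _ R = listed
universal-2-3 (suc (suc (suc (suc (suc (suc (suc (suc (suc (suc (suc c))))))))))) _ R =
  ⊥-elim (refute 1 2 (suc (suc (suc (suc (suc (suc (suc (suc (suc (suc c)))))))))) 9 (R 9))

-- With a = 1, the value 1 needs b ≤ 2: x(x+1) is even and the other two
-- terms are 0 or ≥ 2.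
universal-1 : ∀ b c → 1 ≤ b → b ≤ c → Universal 1 b c → (1 , b , c) ∈ triples
universal-1 1 c _ b≤c R = universal-1-1 c b≤c R
universal-1 2 c _ b≤c R = universal-1-2 c b≤c R
universal-1 (suc (suc (suc b))) (suc (suc (suc c))) _ (s≤s (s≤s (s≤s _))) R =
  ⊥-elim (refute 0 (suc (suc b)) (suc (suc c)) 1 (R 1))

-- With a = 2, the value 2 needs b ≤ 3: x(2x+1) takes the values 0, 1, 3, ...
-- while the other two terms are 0 or ≥ 3.
universal-2 : ∀ b c → 2 ≤ b → b ≤ c → Universal 2 b c → (2 , b , c) ∈ triples
universal-2 1 c (s≤s ()) _ _
universal-2 2 c _ b≤c R = universal-2-2 c b≤c R
universal-2 3 c _ b≤c R = universal-2-3 c b≤c R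
universal-2 (suc (suc (suc (suc b)))) (suc (suc (suc (suc c)))) _ (s≤s (s≤s (s≤s (s≤s _)))) R =
  ⊥-elim (refute 1 (suc (suc (suc b))) (suc (suc (suc c))) 2 (R 2))

-- Main theorem: a ≥ 3 is impossible since then 1 is not represented
-- (all values are 0 or ≥ 2); a = 1 and a = 2 are handled above.
theorem1p1 : (a b c : ℕ) → 1 ≤ a → a ≤ b → b ≤ c → ((n : ℕ) → Represents a b c n) → (a , b , c) ∈ triples
theorem1p1 1 b c _ a≤b b≤c R = universal-1 b c a≤b b≤c R
theorem1p1 2 b c _ a≤b b≤c R = universal-2 b c a≤b b≤c R
theorem1p1 (suc (suc (suc a))) (suc (suc (suc b))) (suc (suc (suc c))) _
           (s≤s (s≤s (s≤s _))) (s≤s (s≤s (s≤s _))) R =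
  ⊥-elim (refute (suc (suc a)) (suc (suc b)) (suc (suc c)) 1 (R 1))
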